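{- Let $p$ and $q$ be positive integers. A graph $G$ is hereditary $(p,q)$-clique-Helly if and only if its clique hypergraph $\mathcal C(G)$ is hereditary $(p,q)$-Helly.
   Context: Graphs are finite, simple and undirected. A clique is a set of pairwise adjacent vertices; maximal means inclusion-wise maximal. The core of a family of sets is the intersection of its members. A family is $(p,q)$-intersecting if every nonempty subfamily of at most $p$ members has core of cardinality at least $q$, and has the $(p,q)$-Helly property if every nonempty $(p,q)$-intersecting subfamily has core of cardinality at least $q$. A graph is $(p,q)$-clique-Helly if the family of its maximal cliques has the $(p,q)$-Helly property, and hereditary $(p,q)$-clique-Helly if every induced subgraph is $(p,q)$-clique-Helly. A hypergraph is a finite vertex set $X$ with a finite family of nonempty subsets (edges) whose union is $X$; it is $(p,q)$-Helly if its edge family has the $(p,q)$-Helly property. For $X'\subseteq X$ the subhypergraph induced by $X'$ has vertex set $X'$ and edges the nonempty intersections of edges with $X'$; a hypergraph is hereditary $(p,q)$-Helly if all its subhypergraphs are $(p,q)$-Helly. The clique hypergraph $\mathcal C(G)$ has vertex set $V(G)$ and edges the maximal cliques of $G$. -}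

module Defs where

open import Data.Nat using (ℕ; _≤_; _≥_)
open import Data.Fin using (Fin)
open import Data.Fin.Subset using (Subset; _∈_; _∉_; _⊆_; _∩_; ⊤; ∣_∣; Nonempty)
open import Data.List using (List; []; _∷_; length; foldr)
open import Data.List.Relation.Unary.All using (All)
open import Data.Product using (Σ; ∃; _×_)
open import Relation.Binary.PropositionalEquality using (_≡_; _≢_)
open import Relation.Nullary using (¬_)
open import Data.List.Membership.Propositional renaming (_∈_ to _∈ₗ_)

record Graph (n : ℕ) : Set₁ where
  field
    Adj     : Fin n → Fin n → Set
    sym     : ∀ {u v} → Adj u v → Adj v u
    irrefl  : ∀ {u} → ¬ Adj u u
open Graph public

Family : ℕ → Set₁
Family n = Subset n → Set

-- Core (intersection) of a finite list of sets; the core of a finite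
-- subfamily is the core of any enumeration of its members.
core : ∀ {n} → List (Subset n) → Subset n
core = foldr _∩_ ⊤

NonemptySubfamily : ∀ {n} → Family n → List (Subset n) → Set
NonemptySubfamily F L = (L ≢ []) × All F L

Intersecting : ∀ {n} → ℕ → ℕ → Family n → Set
Intersecting {n} p q F =
  ∀ (L : List (Subset n)) → NonemptySubfamily F L → length L ≤ p → ∣ core L ∣ ≥ q

Helly : ∀ {n} → ℕ → ℕ → Family n → Set
Helly {n} p q F =
  ∀ (L : List (Subset n)) → NonemptySubfamily F L →
    Intersecting p q (λ S → S ∈ₗ L) → ∣ core L ∣ ≥ q

-- Cliques and maximal cliques of the subgraph of G induced by S ⊆ V(G)
-- (vertex subsets are represented inside the ambient Fin n).
IsClique : ∀ {n} → Graph n → Subset n → Set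
IsClique G C = ∀ {u v} → u ∈ C → v ∈ C → u ≢ v → Adj G u v

IsMaximalCliqueIn : ∀ {n} → Graph n → Subset n → Subset n → Set
IsMaximalCliqueIn G S C =
  C ⊆ S × IsClique G C × (∀ D → IsClique G D → C ⊆ D → D ⊆ S → D ⊆ C)

maximalCliques : ∀ {n} → Graph n → Family n
maximalCliques G = IsMaximalCliqueIn G ⊤

CliqueHelly : ∀ {n} → ℕ → ℕ → Graph n → Set
CliqueHelly p q G = Helly p q (maximalCliques G)

HereditaryCliqueHelly : ∀ {n} → ℕ → ℕ → Graph n → Set
HereditaryCliqueHelly {n} p q G = ∀ (S : Subset n) → Helly p q (IsMaximalCliqueIn G S)

record Hypergraph (n : ℕ) : Set₁ where
  field
    Edge : Family n
open Hypergraph public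

HellyHypergraph : ∀ {n} → ℕ → ℕ → Hypergraph n → Set
HellyHypergraph p q H = Helly p q (Edge H)

induced : ∀ {n} → Hypergraph n → Subset n → Hypergraph n
induced H X' = record { Edge = λ T → Nonempty T × ∃ λ E → Edge H E × T ≡ E ∩ X' }

HereditaryHelly : ∀ {n} → ℕ → ℕ → Hypergraph n → Set
HereditaryHelly {n} p q H = ∀ (X' : Subset n) → HellyHypergraph p q (induced H X')

cliqueHypergraph : ∀ {n} → Graph n → Hypergraph n
cliqueHypergraph G = record { Edge = maximalCliques G }

-- Forward direction: let T₁ … T_m be edges of C(G)[X] with Tᵢ = Eᵢ ∩ X for maximal
-- cliques Eᵢ.  Delete from ⋃ Eᵢ the vertices of the common core ⋂ Eᵢ lying outside X,
-- obtaining S.  Every vertex of S lies in some Eⱼ and is therefore adjacent to the whole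
-- core, so each Eᵢ ∩ S is a maximal clique of G[S]; these cliques contain the Tᵢ, so they
-- inherit (p,q)-intersection, and their core lies inside ⋂ Tᵢ.  Helly for G[S] concludes.
-- Backward direction: a maximal clique of G[S] extends to a maximal clique C of G and
-- equals C ∩ S; it is nonempty because p, q ≥ 1.  Hence the maximal cliques of G[S] are
-- edges of C(G)[S].  Extending cliques needs decidable adjacency, which is available
-- under a double negation because the goal, an inequality of naturals, is decidable.
module Submission where

open import Defs
open import Data.Nat using (ℕ; zero; suc; _+_; _≤_; _≤?_)
open import Data.Nat.Properties using (≤-trans; ≤-reflexive; ≤-antisym; +-identityʳ; +-suc; +-monoˡ-≤; m≤n+m)
open import Function using (_∘_; _⇔_; mk⇔)
open import Data.Fin using (Fin; zero; suc)
open import Data.Fin.Properties using (any?; all?)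
open import Data.Fin.Subset using (Subset; _∈_; _∉_; _⊆_; _∩_; _∪_; ∁; ⋃; ∣_∣; Nonempty; ⁅_⁆)
open import Data.Fin.Subset.Properties
open import Data.List using (List; []; _∷_; map)
open import Data.List.Relation.Unary.All as All using (All; []; _∷_)
open import Data.List.Relation.Unary.All.Properties using (map⁺; map⁻)
open import Data.List.Relation.Unary.Any using (here; there)
open import Data.List.Relation.Binary.Pointwise using (Pointwise; []; _∷_; Pointwise-length)
open import Data.List.Membership.Propositional using () renaming (_∈_ to _∈ₗ_)
open import Data.List.Membership.Propositional.Properties using (∈-map⁺; ∈-map⁻)
open import Data.Product using (∃; _×_; _,_; proj₁; proj₂)
open import Data.Sum as Sum using (_⊎_; inj₁; inj₂)
open import Data.Empty using (⊥-elim)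
open import Relation.Binary.PropositionalEquality as ≡ using (_≡_; _≢_; refl; trans; cong; subst)
open import Relation.Nullary using (¬_; Dec; yes; no; ¬?; _×-dec_; _→-dec_; contradiction)
open import Relation.Nullary.Decidable using (decidable-stable; ¬¬-excluded-middle)
open import Relation.Nullary.Negation using (¬¬-map)

private
  variable
    n p q : ℕ

x∈core⁺ : ∀ {x : Fin n} {L} → All (x ∈_) L → x ∈ core L
x∈core⁺ []         = ∈⊤
x∈core⁺ (x∈A ∷ hs) = x∈p∩q⁺ (x∈A , x∈core⁺ hs)

x∈core⁻ : ∀ {x : Fin n} L → x ∈ core L → All (x ∈_) L
x∈core⁻ []      _ = []
x∈core⁻ (A ∷ L) h = proj₁ (x∈p∩q⁻ A (core L) h) ∷ x∈core⁻ L (proj₂ (x∈p∩q⁻ A (core L) h))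

core-mono : ∀ {L M : List (Subset n)} → Pointwise (λ A B → A ⊆ B) L M → core L ⊆ core M
core-mono []         = λ x∈ → x∈
core-mono (A⊆B ∷ pw) {x} x∈ with x∈p∩q⁻ _ _ x∈
... | x∈A , x∈core = x∈p∩q⁺ (A⊆B x∈A , core-mono pw x∈core)

map≢[] : ∀ {A B : Set} {f : A → B} {xs} → xs ≢ [] → map f xs ≢ []
map≢[] {xs = []}    xs≢[] _ = xs≢[] refl
map≢[] {xs = _ ∷ _} _     ()

core-map-∩⊆ : ∀ (A : Subset n) {L} → L ≢ [] → core (map (_∩ A) L) ⊆ A
core-map-∩⊆ A {[]}    L≢[] _  = contradiction refl L≢[]
core-map-∩⊆ A {E ∷ L} _    x∈ = p∩q⊆q E A (p∩q⊆p (E ∩ A) _ x∈)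

x∈⋃⁺ : ∀ {x : Fin n} {E Es} → E ∈ₗ Es → x ∈ E → x ∈ ⋃ Es
x∈⋃⁺ {Es = E ∷ Es} (here refl) x∈E = x∈p∪q⁺ (inj₁ x∈E)
x∈⋃⁺ {Es = E ∷ Es} (there E∈)  x∈E = x∈p∪q⁺ (inj₂ (x∈⋃⁺ E∈ x∈E))

x∈⋃⁻ : ∀ {x : Fin n} Es → x ∈ ⋃ Es → ∃ λ E → E ∈ₗ Es × x ∈ E
x∈⋃⁻ []       x∈ = ⊥-elim (∉⊥ x∈)
x∈⋃⁻ (E ∷ Es) x∈ with x∈p∪q⁻ E (⋃ Es) x∈
... | inj₁ x∈E = E , here refl , x∈E
... | inj₂ x∈⋃ with x∈⋃⁻ Es x∈⋃
...   | E′ , E′∈ , x∈E′ = E′ , there E′∈ , x∈E′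

1≤∣p∣⇒Nonempty : ∀ {A : Subset n} → 1 ≤ ∣ A ∣ → Nonempty A
1≤∣p∣⇒Nonempty {n} {A} 1≤∣A∣ with nonempty? A
... | yes ne = ne
... | no ¬ne with subst (1 ≤_) (trans (cong ∣_∣ (Empty-unique ¬ne)) (∣⊥∣≡0 n)) 1≤∣A∣
...   | ()

module _ {F F′ : Family n} (refines : ∀ {D} → F′ D → ∃ λ T → F T × T ⊆ D) where

  private
    shrink : ∀ {M} → All F′ M → ∃ λ M′ → All F M′ × Pointwise (λ A B → A ⊆ B) M′ M
    shrink []       = [] , [] , []
    shrink (d ∷ ds) with refines d | shrink ds
    ... | T , FT , T⊆D | M′ , FM′ , pw = T ∷ M′ , FT ∷ FM′ , T⊆D ∷ pw

  intersecting-refines : Intersecting p q F → Intersecting p q F′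
  intersecting-refines inter []      (M≢[] , _) _ = contradiction refl M≢[]
  intersecting-refines {p = p} inter (_ ∷ _) (_ , ds) ∣M∣≤p with shrink ds
  ... | M′@(_ ∷ _) , FM′ , pw =
    ≤-trans (inter M′ ((λ ()) , FM′) (subst (_≤ p) (≡.sym (Pointwise-length pw)) ∣M∣≤p))
            (p⊆q⇒∣p∣≤∣q∣ (core-mono pw))

intersecting⇒Nonempty : ∀ {F : Family n} {D} → 1 ≤ p → 1 ≤ q → Intersecting p q F →
                        F D → Nonempty D
intersecting⇒Nonempty {D = D} 1≤p 1≤q inter FD = 1≤∣p∣⇒Nonempty
  (≤-trans 1≤q (subst (λ A → _ ≤ ∣ A ∣) (∩-identityʳ D) (inter (D ∷ []) ((λ ()) , FD ∷ []) 1≤p)))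

x∈p∪⁅y⁆⁻ : ∀ {x : Fin n} (A : Subset n) y → x ∈ A ∪ ⁅ y ⁆ → x ∈ A ⊎ x ≡ y
x∈p∪⁅y⁆⁻ A y x∈ = Sum.map₂ (x∈⁅y⁆⇒x≡y y) (x∈p∪q⁻ A ⁅ y ⁆ x∈)

n≤∣p∣⇒x∈p : ∀ {A : Subset n} {x} → n ≤ ∣ A ∣ → x ∈ A
n≤∣p∣⇒x∈p {A = A} n≤∣A∣ = subst (_ ∈_) (≡.sym (∣p∣≡n⇒p≡⊤ (≤-antisym (∣p∣≤n A) n≤∣A∣))) ∈⊤

¬¬-∀-Fin : ∀ {P : Fin n → Set} → (∀ i → ¬ ¬ P i) → ¬ ¬ (∀ i → P i)
¬¬-∀-Fin {zero}  _   k = k (λ ())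
¬¬-∀-Fin {suc n} ¬¬P k =
  ¬¬P zero λ P0 → ¬¬-∀-Fin (¬¬P ∘ suc) λ Psuc → k λ { zero → P0 ; (suc i) → Psuc i }

module _ (G : Graph n) where

  isClique-⊆ : ∀ {C D} → IsClique G C → D ⊆ C → IsClique G D
  isClique-⊆ clC D⊆C u∈D v∈D = clC (D⊆C u∈D) (D⊆C v∈D)

  isClique-∪⁅⁆ : ∀ {C v} → IsClique G C → (∀ {u} → u ∈ C → v ≢ u → Adj G v u) →
                 IsClique G (C ∪ ⁅ v ⁆)
  isClique-∪⁅⁆ {C} {v} clC adj a∈ b∈ a≢b with x∈p∪⁅y⁆⁻ C v a∈ | x∈p∪⁅y⁆⁻ C v b∈
  ... | inj₁ a∈C | inj₁ b∈C = clC a∈C b∈C a≢b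
  ... | inj₁ a∈C | inj₂ refl = Graph.sym G (adj a∈C (a≢b ∘ ≡.sym))
  ... | inj₂ refl | inj₁ b∈C = adj b∈C a≢b
  ... | inj₂ refl | inj₂ refl = contradiction refl a≢b

  adjacent⇒∈-maximal : ∀ {S C v} → IsMaximalCliqueIn G S C → v ∈ S →
                       (∀ {u} → u ∈ C → v ≢ u → Adj G v u) → v ∈ C
  adjacent⇒∈-maximal {S} {C} {v} (C⊆S , clC , maximal) v∈S adj =
    maximal (C ∪ ⁅ v ⁆) (isClique-∪⁅⁆ clC adj) (p⊆p∪q ⁅ v ⁆) C∪v⊆S (x∈p∪q⁺ (inj₂ (x∈⁅x⁆ v)))
    where
    C∪v⊆S : C ∪ ⁅ v ⁆ ⊆ S
    C∪v⊆S x∈ with x∈p∪⁅y⁆⁻ C v x∈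
    ... | inj₁ x∈C = C⊆S x∈C
    ... | inj₂ refl = v∈S

  ∩-isMaximalCliqueIn : ∀ {S C} → maximalCliques G C →
                        (∀ {v b} → v ∈ S → b ∈ C → b ∉ S → v ≢ b → Adj G v b) →
                        IsMaximalCliqueIn G S (C ∩ S)
  ∩-isMaximalCliqueIn {S} {C} maxC@(_ , clC , _) adj-cut =
    p∩q⊆q C S , isClique-⊆ clC (p∩q⊆p C S) , maximal
    where
    maximal : ∀ D → IsClique G D → C ∩ S ⊆ D → D ⊆ S → D ⊆ C ∩ S
    maximal D clD C∩S⊆D D⊆S {v} v∈D = x∈p∩q⁺ (adjacent⇒∈-maximal maxC ∈⊤ adj , D⊆S v∈D)
      where
      adj : ∀ {b} → b ∈ C → v ≢ b → Adj G v b
      adj {b} b∈C v≢b with b ∈? S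
      ... | yes b∈S = clD v∈D (C∩S⊆D (x∈p∩q⁺ (b∈C , b∈S))) v≢b
      ... | no b∉S  = adj-cut (D⊆S v∈D) b∈C b∉S v≢b

  maximalIn⇒∩-maximal : (∀ {D} → IsClique G D → ∃ λ C → maximalCliques G C × D ⊆ C) →
                        ∀ {S D} → IsMaximalCliqueIn G S D →
                        ∃ λ C → maximalCliques G C × D ≡ C ∩ S
  maximalIn⇒∩-maximal extend {S} {D} (D⊆S , clD , maximal) with extend clD
  ... | C , maxC@(_ , clC , _) , D⊆C =
    let D⊆C∩S : D ⊆ C ∩ S
        D⊆C∩S x∈D = x∈p∩q⁺ (D⊆C x∈D , D⊆S x∈D)
    in C , maxC , ⊆-antisym D⊆C∩S (maximal (C ∩ S) (isClique-⊆ clC (p∩q⊆p C S)) D⊆C∩S (p∩q⊆q C S))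

  ¬¬-decidable-Adj : ¬ ¬ (∀ u v → Dec (Adj G u v))
  ¬¬-decidable-Adj = ¬¬-∀-Fin λ u → ¬¬-∀-Fin λ v → ¬¬-excluded-middle

module _ (G : Graph n) (adj? : ∀ u v → Dec (Adj G u v)) where

  private
    Extends : Subset n → Fin n → Set
    Extends C v = v ∉ C × (∀ u → u ∈ C → Adj G v u)

    extends? : ∀ C v → Dec (Extends C v)
    extends? C v = ¬? (v ∈? C) ×-dec all? (λ u → u ∈? C →-dec adj? v u)

    unextendable⇒maximal : ∀ {C} → IsClique G C → ¬ ∃ (Extends C) → maximalCliques G C
    unextendable⇒maximal {C} clC none = ⊆⊤ , clC , λ D clD C⊆D _ {v} v∈D →
      decidable-stable (v ∈? C) λ v∉C →
        none (v , v∉C , λ u u∈C → clD v∈D (C⊆D u∈C) λ { refl → v∉C u∈C })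

    -- k bounds the number of vertices that can still be added to C.
    extend : ∀ k {C} → IsClique G C → n ≤ ∣ C ∣ + k → ∃ λ M → maximalCliques G M × C ⊆ M
    extend k {C} clC bound with any? (extends? C) | k
    ... | no none | _ = C , unextendable⇒maximal clC none , λ x∈ → x∈
    ... | yes (v , v∉C , _) | zero = contradiction (n≤∣p∣⇒x∈p (subst (n ≤_) (+-identityʳ _) bound)) v∉C
    ... | yes (v , v∉C , adj) | suc k
      with extend k (isClique-∪⁅⁆ G clC λ u∈C _ → adj _ u∈C) (≤-trans bound (grows k))
      where
      grows : ∀ k → ∣ C ∣ + suc k ≤ ∣ C ∪ ⁅ v ⁆ ∣ + k
      grows k = ≤-trans (≤-reflexive (+-suc ∣ C ∣ k))
                        (+-monoˡ-≤ k (p⊂q⇒∣p∣<∣q∣ (p⊆p∪q ⁅ v ⁆ , v , x∈p∪q⁺ (inj₂ (x∈⁅x⁆ v)) , v∉C)))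
    ...   | M , maxM , C∪v⊆M = M , maxM , C∪v⊆M ∘ p⊆p∪q ⁅ v ⁆

  extendToMaximalClique : ∀ {C} → IsClique G C → ∃ λ M → maximalCliques G M × C ⊆ M
  extendToMaximalClique {C} clC = extend n clC (m≤n+m n ∣ C ∣)

induced-edges : ∀ {H : Hypergraph n} {X L} → All (Edge (induced H X)) L →
                ∃ λ Es → All (Edge H) Es × L ≡ map (_∩ X) Es
induced-edges []                           = [] , [] , refl
induced-edges ((_ , E , HE , refl) ∷ es) with induced-edges es
... | Es , HEs , refl = E ∷ Es , HE ∷ HEs , refl

module _ (G : Graph n) (X : Subset n) (Es : List (Subset n))
         (maxEs : All (maximalCliques G) Es) where

  trim : Subset n
  trim = ⋃ Es ∩ (X ∪ ∁ (core Es))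

  private
    cut⇒∈core : ∀ {E b} → E ∈ₗ Es → b ∈ E → b ∉ trim → b ∈ core Es
    cut⇒∈core E∈ b∈E b∉trim = x∉∁p⇒x∈p λ b∈∁ → b∉trim (x∈p∩q⁺ (x∈⋃⁺ E∈ b∈E , x∈p∪q⁺ (inj₂ b∈∁)))

    ∩trim-maximal : ∀ {E} → E ∈ₗ Es → IsMaximalCliqueIn G trim (E ∩ trim)
    ∩trim-maximal E∈ = ∩-isMaximalCliqueIn G (All.lookup maxEs E∈) λ v∈trim b∈E b∉trim v≢b →
      let E′ , E′∈ , v∈E′ = x∈⋃⁻ Es (p∩q⊆p _ _ v∈trim)
          b∈E′ = All.lookup (x∈core⁻ Es (cut⇒∈core E∈ b∈E b∉trim)) E′∈
      in proj₁ (proj₂ (All.lookup maxEs E′∈)) v∈E′ b∈E′ v≢b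

    ∩X⊆∩trim : ∀ {E} → E ∈ₗ Es → E ∩ X ⊆ E ∩ trim
    ∩X⊆∩trim {E} E∈ x∈ with x∈p∩q⁻ E X x∈
    ... | x∈E , x∈X = x∈p∩q⁺ (x∈E , x∈p∩q⁺ (x∈⋃⁺ E∈ x∈E , x∈p∪q⁺ (inj₁ x∈X)))

    core-∩trim⊆core-∩X : Es ≢ [] → core (map (_∩ trim) Es) ⊆ core (map (_∩ X) Es)
    core-∩trim⊆core-∩X Es≢[] {x} x∈ = x∈core⁺ (map⁺ (All.map (λ x∈E → x∈p∩q⁺ (x∈E , x∈X)) x∈Es))
      where
      x∈Es : All (x ∈_) Es
      x∈Es = All.map (λ {E} → p∩q⊆p E trim) (map⁻ (x∈core⁻ (map (_∩ trim) Es) x∈))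
      x∈X : x ∈ X
      x∈X with x∈p∪q⁻ X _ (p∩q⊆q (⋃ Es) _ (core-map-∩⊆ trim Es≢[] x∈))
      ... | inj₁ x∈X = x∈X
      ... | inj₂ x∈∁ = contradiction (x∈core⁺ x∈Es) (x∈∁p⇒x∉p x∈∁)

  helly-∩ : Helly p q (IsMaximalCliqueIn G trim) → Es ≢ [] →
            Intersecting p q (_∈ₗ map (_∩ X) Es) → q ≤ ∣ core (map (_∩ X) Es) ∣
  helly-∩ helly Es≢[] inter =
    ≤-trans (helly (map (_∩ trim) Es) (map≢[] Es≢[] , map⁺ (All.tabulate ∩trim-maximal))
                   (intersecting-refines refines inter))
            (p⊆q⇒∣p∣≤∣q∣ (core-∩trim⊆core-∩X Es≢[]))
    where
    refines : ∀ {D} → D ∈ₗ map (_∩ trim) Es → ∃ λ T → T ∈ₗ map (_∩ X) Es × T ⊆ D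
    refines D∈ with ∈-map⁻ (_∩ trim) D∈
    ... | E , E∈ , refl = E ∩ X , ∈-map⁺ (_∩ X) E∈ , ∩X⊆∩trim E∈

hereditaryCliqueHelly⇒hereditaryHelly : (G : Graph n) → HereditaryCliqueHelly p q G →
                                        HereditaryHelly p q (cliqueHypergraph G)
hereditaryCliqueHelly⇒hereditaryHelly G hch X L (L≢[] , edges) inter with induced-edges edges
... | Es , maxEs , refl = helly-∩ G X Es maxEs (hch (trim G X Es maxEs)) (λ { refl → L≢[] refl }) inter

hereditaryHelly⇒hereditaryCliqueHelly : 1 ≤ p → 1 ≤ q → (G : Graph n) →
                                        HereditaryHelly p q (cliqueHypergraph G) →
                                        HereditaryCliqueHelly p q G
hereditaryHelly⇒hereditaryCliqueHelly {q = q} 1≤p 1≤q G hh S L (L≢[] , maxs) inter =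
  decidable-stable (q ≤? ∣ core L ∣) (¬¬-map helly (¬¬-decidable-Adj G))
  where
  helly : (∀ u v → Dec (Adj G u v)) → q ≤ ∣ core L ∣
  helly adj? = hh S L (L≢[] , All.tabulate isEdge) inter
    where
    isEdge : ∀ {D} → D ∈ₗ L → Edge (induced (cliqueHypergraph G) S) D
    isEdge D∈L with maximalIn⇒∩-maximal G (extendToMaximalClique G adj?) (All.lookup maxs D∈L)
    ... | C , maxC , D≡C∩S = intersecting⇒Nonempty 1≤p 1≤q inter D∈L , C , maxC , D≡C∩S

corollary3p13 : (p q : ℕ) → 1 ≤ p → 1 ≤ q → (n : ℕ) → (G : Graph n) →
    HereditaryCliqueHelly p q G ⇔ HereditaryHelly p q (cliqueHypergraph G)
corollary3p13 p q 1≤p 1≤q n G =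
  mk⇔ (hereditaryCliqueHelly⇒hereditaryHelly G) (hereditaryHelly⇒hereditaryCliqueHelly 1≤p 1≤q G)
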